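{- Let $m$ and $n$ be positive integers and let $a$ be a nonzero complex number. Then $$\sum_{k=0}^{n-1}\binom ak^m\sum_{r=0}^{[\frac{m-1}2]}\binom m{2r+1}\Big(1-\frac2ak\Big)^{2r+1}=2^{m-1}\binom{a-1}{n-1}^m,$$ $$\sum_{k=0}^{n-1}(-1)^k\binom ak^m\sum_{r=0}^{[m/2]}\binom m{2r}\Big(1-\frac2ak\Big)^{2r}=2^{m-1}(-1)^{n-1}\binom{a-1}{n-1}^m.$$
   Context: The general binomial coefficient is $\binom a0=1$, $\binom ak=a(a-1)\cdots(a-k+1)/k!$ for $k\ge1$. $[x]$ is the greatest integer not exceeding $x$. -}

module Defs where

open import Level using (suc; _⊔_)
open import Data.Nat as ℕ using (ℕ; zero) renaming (suc to sucℕ)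
open import Algebra.Bundles using (CommutativeRing; Semiring)
import Algebra.Definitions.RawMonoid as RawMonoidDefs
import Algebra.Definitions.RawSemiring as RawSemiringDefs
open import Relation.Nullary using (¬_)
open import Data.Nat.Combinatorics using (_C_)
open import Data.Product using (_×_)

-- A field of characteristic zero (the complex numbers are one).
record CharZeroField c ℓ : Set (suc (c ⊔ ℓ)) where
  field
    commutativeRing : CommutativeRing c ℓ
  open CommutativeRing commutativeRing public
  open RawMonoidDefs +-rawMonoid public using () renaming (_×_ to _·1_)
  open RawSemiringDefs (Semiring.rawSemiring semiring) public using (_^_)
  field
    _⁻¹      : Carrier → Carrier
    ⁻¹-inverse : ∀ x → ¬ (x ≈ 0#) → x * (x ⁻¹) ≈ 1#
    charZero   : ∀ n → ¬ ((sucℕ n ·1 1#) ≈ 0#)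

module _ {c ℓ} (F : CharZeroField c ℓ) where
  open CharZeroField F

  ι : ℕ → Carrier
  ι n = n ·1 1#

  Σ< : ℕ → (ℕ → Carrier) → Carrier
  Σ< zero     f = 0#
  Σ< (sucℕ n) f = Σ< n f + f n

  falling : Carrier → ℕ → Carrier
  falling a zero     = 1#
  falling a (sucℕ k) = falling a k * (a - ι k)

  binom : Carrier → ℕ → Carrier
  binom a k = falling a k * (ι (k ℕ.!) ⁻¹)

  Lemma2p1 : ℕ → ℕ → Carrier → Set ℓ
  Lemma2p1 m n a =
    (Σ< n (λ k → (binom a k ^ m) *
        Σ< (sucℕ ((m ℕ.∸ 1) ℕ./ 2)) (λ r → ι (m C (2 ℕ.* r ℕ.+ 1)) * (t k ^ (2 ℕ.* r ℕ.+ 1))))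
      ≈ ι (2 ℕ.^ (m ℕ.∸ 1)) * (binom (a - 1#) (n ℕ.∸ 1) ^ m))
    ×
    (Σ< n (λ k → ((- 1#) ^ k) * (binom a k ^ m) *
        Σ< (sucℕ (m ℕ./ 2)) (λ r → ι (m C (2 ℕ.* r)) * (t k ^ (2 ℕ.* r))))
      ≈ ι (2 ℕ.^ (m ℕ.∸ 1)) * ((- 1#) ^ (n ℕ.∸ 1)) * (binom (a - 1#) (n ℕ.∸ 1) ^ m))
    where
      t : ℕ → Carrier
      t k = 1# - ι 2 * (a ⁻¹) * ι k

{-# OPTIONS --safe #-}
-- Write t = 1 - (2/a) k.  Since binom a k (a - k) = a binom (a-1) k and binom a k k = a binom (a-1) (k-1),
-- we get binom a k (1 + t) = 2 binom (a-1) k and binom a k (1 - t) = 2 binom (a-1) (k-1).  The inner sums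
-- are the odd and even parts of the binomial expansion of (1 + t)^m, i.e. ((1 + t)^m ∓ (1 - t)^m)/2, so the
-- k-th summand is 2^(m-1) (binom (a-1) k ^ m ∓ binom (a-1) (k-1) ^ m), times (-1)^k in the second identity,
-- and both sums telescope.
module Submission where

open import Defs
open import Data.Nat as ℕ using (ℕ; zero; suc; 2+; NonZero; z≤n; s≤s; _!)
import Data.Nat.Properties as ℕₚ
open import Data.Nat.DivMod using (_/_; _%_; m≡m%n+[m/n]*n; m%n<n; m/n≤m)
open import Data.Nat.Combinatorics using (_C_; k>n⇒nCk≡0)
open import Data.Fin.Base using (toℕ)
open import Data.Vec.Functional using (Vector; init; last)
open import Data.Fin.Properties using (toℕ-inject₁; toℕ-fromℕ)
open import Data.Product using (_,_)
open import Data.Sum using (inj₁; inj₂)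
open import Data.Empty using (⊥-elim)
import Relation.Binary.PropositionalEquality as ≡
open import Relation.Nullary using (¬_)

n<2*suc[n/2] : ∀ n → n ℕ.< 2 ℕ.* suc (n / 2)
n<2*suc[n/2] n = begin-strict
  n                 ≡⟨ m≡m%n+[m/n]*n n 2 ⟩
  n % 2 + n / 2 * 2 <⟨ ℕₚ.+-monoˡ-< (n / 2 * 2) (m%n<n n 2) ⟩
  2 + n / 2 * 2     ≡⟨ ≡.cong (2 +_) (ℕₚ.*-comm (n / 2) 2) ⟩
  2 + 2 * (n / 2)   ≡⟨ ℕₚ.*-distribˡ-+ 2 1 (n / 2) ⟨
  2 * suc (n / 2)   ∎
  where open import Data.Nat.Base using (_+_; _*_)
        open ℕₚ.≤-Reasoning

module _ {c ℓ} (F : CharZeroField c ℓ) where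
  open CharZeroField F
  open import Algebra.Properties.Ring ring
    using (-1*x≈-x; -0#≈0#; -‿+-comm; -‿distribˡ-*; -‿distribʳ-*; -‿involutive; ⁻¹-anti-homo‿-; x[y-z]≈xy-xz)
  open import Algebra.Properties.Monoid.Sum +-monoid using (sum; sum⁺-syntax; sum-cong-≋; sum-init-last)
  open import Algebra.Properties.Monoid.Mult +-monoid using (×-congʳ)
  open import Algebra.Properties.Semiring.Mult semiring using (×-assoc-*; ×1-homo-*)
  open import Algebra.Properties.Semiring.Exp semiring using (^-congˡ; ^-assocʳ; ^-homo-*)
  open import Algebra.Properties.CommutativeSemiring.Exp commutativeSemiring using (^-distrib-*)
  open import Algebra.Properties.CommutativeSemigroup *-commutativeSemigroup using (x∙yz≈y∙xz)
  import Algebra.Properties.CommutativeSemiring.Binomial commutativeSemiring as Binomial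
  open import Relation.Binary.Reasoning.Setoid setoid
  open import Algebra.Solver.Ring.NaturalCoefficients.Default commutativeSemiring

  ι-homo-^ : ∀ n k → ι F (n ℕ.^ k) ≈ ι F n ^ k
  ι-homo-^ n zero    = +-identityʳ 1#
  ι-homo-^ n (suc k) = trans (×1-homo-* n (n ℕ.^ k)) (*-congˡ (ι-homo-^ n k))

  ι-≉0 : ∀ n .{{_ : NonZero n}} → ¬ ι F n ≈ 0#
  ι-≉0 (suc n) = charZero n

  *-cancelˡ-≉0 : ∀ {c x y} → ¬ c ≈ 0# → c * x ≈ c * y → x ≈ y
  *-cancelˡ-≉0 {c} {x} {y} c≉0 cx≈cy = begin
    x                  ≈⟨ *-identityˡ x ⟨
    1# * x             ≈⟨ *-congʳ c⁻¹*c≈1 ⟨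
    (c ⁻¹ * c) * x     ≈⟨ *-assoc _ _ _ ⟩
    c ⁻¹ * (c * x)     ≈⟨ *-congˡ cx≈cy ⟩
    c ⁻¹ * (c * y)     ≈⟨ *-assoc _ _ _ ⟨
    (c ⁻¹ * c) * y     ≈⟨ *-congʳ c⁻¹*c≈1 ⟩
    1# * y             ≈⟨ *-identityˡ y ⟩
    y                  ∎
    where c⁻¹*c≈1 = trans (*-comm _ _) (⁻¹-inverse c c≉0)

  ι[k!]≉0 : ∀ k → ¬ ι F (k !) ≈ 0#
  ι[k!]≉0 k = ι-≉0 (k !) {{k ℕₚ.!≢0}}

  x*a⁻¹*a≈x : ∀ {a} → ¬ a ≈ 0# → ∀ x → x * a ⁻¹ * a ≈ x
  x*a⁻¹*a≈x {a} a≉0 x = trans (*-assoc _ _ _) (trans (*-congˡ (trans (*-comm _ _) (⁻¹-inverse a a≉0))) (*-identityʳ x))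

  *-cancelʳ-≉0 : ∀ {c x y} → ¬ c ≈ 0# → x * c ≈ y * c → x ≈ y
  *-cancelʳ-≉0 {c} {x} {y} c≉0 xc≈yc = *-cancelˡ-≉0 c≉0 (trans (*-comm c x) (trans xc≈yc (*-comm y c)))

  x*y≈z*w⇒xⁿ*yⁿ≈zⁿ*wⁿ : ∀ n {x y z w} → x * y ≈ z * w → x ^ n * y ^ n ≈ z ^ n * w ^ n
  x*y≈z*w⇒xⁿ*yⁿ≈zⁿ*wⁿ n {x} {y} {z} {w} xy≈zw =
    trans (sym (^-distrib-* x y n)) (trans (^-congˡ n xy≈zw) (^-distrib-* z w n))

  -x*-x≈x*x : ∀ x → (- x) * (- x) ≈ x * x
  -x*-x≈x*x x = begin
    (- x) * (- x)   ≈⟨ -‿distribˡ-* x (- x) ⟨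
    - (x * (- x))   ≈⟨ -‿cong (-‿distribʳ-* x x) ⟨
    - (- (x * x))   ≈⟨ -‿involutive (x * x) ⟩
    x * x           ∎

  -x^[2r]≈x^[2r] : ∀ x r → (- x) ^ (2 ℕ.* r) ≈ x ^ (2 ℕ.* r)
  -x^[2r]≈x^[2r] x r = begin
    (- x) ^ (2 ℕ.* r)   ≈⟨ ^-assocʳ (- x) 2 r ⟨
    ((- x) ^ 2) ^ r     ≈⟨ ^-congˡ r (*-congˡ (*-identityʳ (- x))) ⟩
    ((- x) * (- x)) ^ r ≈⟨ ^-congˡ r (-x*-x≈x*x x) ⟩
    (x * x) ^ r         ≈⟨ ^-congˡ r (*-congˡ (*-identityʳ x)) ⟨
    (x ^ 2) ^ r         ≈⟨ ^-assocʳ x 2 r ⟩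
    x ^ (2 ℕ.* r)       ∎

  -x^[2r+1]≈-x^[2r+1] : ∀ x r → (- x) ^ (2 ℕ.* r ℕ.+ 1) ≈ - x ^ (2 ℕ.* r ℕ.+ 1)
  -x^[2r+1]≈-x^[2r+1] x r = begin
    (- x) ^ (2 ℕ.* r ℕ.+ 1)       ≈⟨ ^-homo-* (- x) (2 ℕ.* r) 1 ⟩
    (- x) ^ (2 ℕ.* r) * (- x * 1#) ≈⟨ *-cong (-x^[2r]≈x^[2r] x r) (sym (-‿distribˡ-* x 1#)) ⟩
    x ^ (2 ℕ.* r) * - (x * 1#)    ≈⟨ -‿distribʳ-* _ _ ⟨
    - (x ^ (2 ℕ.* r) * (x * 1#))  ≈⟨ -‿cong (^-homo-* x (2 ℕ.* r) 1) ⟨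
    - x ^ (2 ℕ.* r ℕ.+ 1)         ∎

  1-[1-x]≈x : ∀ x → 1# - (1# - x) ≈ x
  1-[1-x]≈x x = begin
    1# - (1# - x)  ≈⟨ +-congˡ (⁻¹-anti-homo‿- 1# x) ⟩
    1# + (x - 1#)  ≈⟨ solve 3 (λ o x -o → o :+ (x :+ -o) := x :+ (o :+ -o)) refl 1# x (- 1#) ⟩
    x + (1# - 1#)  ≈⟨ +-congˡ (-‿inverseʳ 1#) ⟩
    x + 0#         ≈⟨ +-identityʳ x ⟩
    x              ∎

  [x+y]+[x-y]≈x+x : ∀ x y → (x + y) + (x - y) ≈ x + x
  [x+y]+[x-y]≈x+x x y = begin
    (x + y) + (x - y)   ≈⟨ solve 3 (λ x y -y → (x :+ y) :+ (x :+ -y) := (x :+ x) :+ (y :+ -y)) refl x y (- y) ⟩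
    (x + x) + (y - y)   ≈⟨ +-congˡ (-‿inverseʳ y) ⟩
    (x + x) + 0#        ≈⟨ +-identityʳ _ ⟩
    x + x               ∎

  [x+y]-[x-y]≈y+y : ∀ x y → (x + y) - (x - y) ≈ y + y
  [x+y]-[x-y]≈y+y x y = begin
    (x + y) - (x - y)   ≈⟨ +-congˡ (⁻¹-anti-homo‿- x y) ⟩
    (x + y) + (y - x)   ≈⟨ solve 3 (λ x y -x → (x :+ y) :+ (y :+ -x) := (y :+ y) :+ (x :+ -x)) refl x y (- x) ⟩
    (y + y) + (x - x)   ≈⟨ +-congˡ (-‿inverseʳ x) ⟩
    (y + y) + 0#        ≈⟨ +-identityʳ _ ⟩
    y + y               ∎

  Σ<-cong : ∀ n {f g} → (∀ k → f k ≈ g k) → Σ< F n f ≈ Σ< F n g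
  Σ<-cong zero    f≈g = refl
  Σ<-cong (suc n) f≈g = +-cong (Σ<-cong n f≈g) (f≈g n)

  *-distribˡ-Σ< : ∀ n x f → x * Σ< F n f ≈ Σ< F n (λ k → x * f k)
  *-distribˡ-Σ< zero    x f = zeroʳ x
  *-distribˡ-Σ< (suc n) x f = trans (distribˡ x (Σ< F n f) (f n)) (+-congʳ (*-distribˡ-Σ< n x f))

  Σ<-vanishing-tail : ∀ {K} f → (∀ j → K ℕ.≤ j → f j ≈ 0#) → ∀ {M} → K ℕ.≤ M → Σ< F M f ≈ Σ< F K f
  Σ<-vanishing-tail f f≈0 {zero}  z≤n = refl
  Σ<-vanishing-tail {K} f f≈0 {suc M} K≤1+M with ℕₚ.m≤n⇒m<n∨m≡n K≤1+M
  ... | inj₂ ≡.refl = refl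
  ... | inj₁ K<1+M  = begin
    Σ< F M f + f M ≈⟨ +-cong (Σ<-vanishing-tail f f≈0 K≤M) (f≈0 M K≤M) ⟩
    Σ< F K f + 0#  ≈⟨ +-identityʳ _ ⟩
    Σ< F K f       ∎
    where K≤M = ℕₚ.≤-pred K<1+M

  Σ<-even-odd : ∀ M f → Σ< F (2 ℕ.* M) f ≈ Σ< F M (λ r → f (2 ℕ.* r)) + Σ< F M (λ r → f (2 ℕ.* r ℕ.+ 1))
  Σ<-even-odd zero    f = sym (+-identityˡ 0#)
  Σ<-even-odd (suc M) f = begin
    Σ< F (2 ℕ.* suc M) f                             ≡⟨ ≡.cong (λ N → Σ< F N f) (ℕₚ.*-suc 2 M) ⟩
    Σ< F (2 ℕ.* M) f + f (2 ℕ.* M) + f (suc (2 ℕ.* M)) ≈⟨ +-cong (+-congʳ (Σ<-even-odd M f)) (reflexive (≡.cong f (ℕₚ.+-comm 1 (2 ℕ.* M)))) ⟩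
    Evens + Odds + f (2 ℕ.* M) + f (2 ℕ.* M ℕ.+ 1)   ≈⟨ solve 4 (λ e o x y → e :+ o :+ x :+ y := (e :+ x) :+ (o :+ y)) refl Evens Odds _ _ ⟩
    (Evens + f (2 ℕ.* M)) + (Odds + f (2 ℕ.* M ℕ.+ 1)) ∎
    where
      Evens = Σ< F M (λ r → f (2 ℕ.* r))
      Odds  = Σ< F M (λ r → f (2 ℕ.* r ℕ.+ 1))

  Σ<-telescope : ∀ n (g : ℕ → Carrier) → Σ< F n (λ k → g (suc k) - g k) ≈ g n - g 0
  Σ<-telescope zero    g = sym (-‿inverseʳ (g 0))
  Σ<-telescope (suc n) g = begin
    Σ< F n (λ k → g (suc k) - g k) + (g (suc n) - g n) ≈⟨ +-congʳ (Σ<-telescope n g) ⟩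
    (g n - g 0) + (g (suc n) - g n)                     ≈⟨ solve 4 (λ x y z -x → (x :+ y) :+ (z :+ -x) := (z :+ y) :+ (x :+ -x))
                                                            refl (g n) (- g 0) (g (suc n)) (- g n) ⟩
    (g (suc n) - g 0) + (g n - g n)                     ≈⟨ +-congˡ (-‿inverseʳ (g n)) ⟩
    (g (suc n) - g 0) + 0#                              ≈⟨ +-identityʳ _ ⟩
    g (suc n) - g 0                                     ∎

  Σ<-alternating-telescope : ∀ n (g : ℕ → Carrier) →
    Σ< F (suc n) (λ k → (- 1#) ^ k * (g (suc k) + g k)) ≈ g 0 + (- 1#) ^ n * g (suc n)
  Σ<-alternating-telescope zero    g =
    solve 2 (λ x y → con 0 :+ con 1 :* (y :+ x) := x :+ con 1 :* y) refl (g 0) (g 1)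
  Σ<-alternating-telescope (suc n) g = begin
    Σ< F (suc n) (λ k → (- 1#) ^ k * (g (suc k) + g k)) + (- 1#) ^ suc n * (g (2+ n) + g (suc n))
      ≈⟨ +-cong (Σ<-alternating-telescope n g) (*-congʳ (-1*x≈-x s)) ⟩
    g 0 + s * g (suc n) + (- s) * (g (2+ n) + g (suc n))
      ≈⟨ solve 5 (λ x s -s y z → x :+ s :* y :+ -s :* (z :+ y) := x :+ -s :* z :+ (s :+ -s) :* y)
           refl (g 0) s (- s) (g (suc n)) (g (2+ n)) ⟩
    g 0 + (- s) * g (2+ n) + (s - s) * g (suc n)
      ≈⟨ +-congˡ (trans (*-congʳ (-‿inverseʳ s)) (zeroˡ _)) ⟩
    g 0 + (- s) * g (2+ n) + 0#
      ≈⟨ trans (+-identityʳ _) (+-congˡ (*-congʳ (sym (-1*x≈-x s)))) ⟩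
    g 0 + (- 1#) ^ suc n * g (2+ n) ∎
    where s = (- 1#) ^ n

  Σ<≈sum : ∀ n f → Σ< F n f ≈ sum {n} (λ i → f (toℕ i))
  Σ<≈sum zero    f = refl
  Σ<≈sum (suc n) f = begin
    Σ< F n f + f n                     ≈⟨ +-cong (Σ<≈sum n f) (reflexive (≡.cong f (≡.sym (toℕ-fromℕ n)))) ⟩
    sum {n} (λ i → f (toℕ i)) + last v ≈⟨ +-congʳ (sum-cong-≋ {n} (λ i → reflexive (≡.cong f (≡.sym (toℕ-inject₁ i))))) ⟩
    sum (init v) + last v              ≈⟨ sum-init-last v ⟨
    sum v                              ∎
    where
      v : Vector Carrier (suc n)
      v i = f (toℕ i)

  1#^n≈1# : ∀ n → 1# ^ n ≈ 1#
  1#^n≈1# zero    = refl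
  1#^n≈1# (suc n) = trans (*-identityˡ _) (1#^n≈1# n)

  binomial-theorem : ∀ m u → Σ< F (suc m) (λ j → ι F (m C j) * u ^ j) ≈ (1# + u) ^ m
  binomial-theorem m u = begin
    Σ< F (suc m) (λ j → ι F (m C j) * u ^ j)       ≈⟨ Σ<≈sum (suc m) _ ⟩
    ∑[ k ≤ m ] (ι F (m C toℕ k) * u ^ toℕ k)        ≈⟨ sum-cong-≋ {suc m} (λ k → term (toℕ k)) ⟩
    Binomial.binomialExpansion u 1# m               ≈⟨ Binomial.theorem m u 1# ⟨
    (u + 1#) ^ m                                    ≈⟨ ^-congˡ m (+-comm u 1#) ⟩
    (1# + u) ^ m                                    ∎
    where
      term : ∀ j → ι F (m C j) * u ^ j ≈ (m C j) ·1 (u ^ j * 1# ^ (m ℕ.∸ j))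
      term j = begin
        ι F (m C j) * u ^ j                ≈⟨ ×-assoc-* (m C j) 1# (u ^ j) ⟩
        (m C j) ·1 (1# * u ^ j)            ≈⟨ ×-congʳ (m C j) (*-identityˡ (u ^ j)) ⟩
        (m C j) ·1 (u ^ j)                 ≈⟨ ×-congʳ (m C j) (*-identityʳ (u ^ j)) ⟨
        (m C j) ·1 (u ^ j * 1#)            ≈⟨ ×-congʳ (m C j) (*-congˡ (1#^n≈1# (m ℕ.∸ j))) ⟨
        (m C j) ·1 (u ^ j * 1# ^ (m ℕ.∸ j)) ∎

  binomialTerm-vanishes : ∀ m u {j} → m ℕ.< j → ι F (m C j) * u ^ j ≈ 0#
  binomialTerm-vanishes m u m<j = trans (*-congʳ (reflexive (≡.cong (ι F) (k>n⇒nCk≡0 m<j)))) (zeroˡ _)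

  evenBinomialSum oddBinomialSum : ℕ → Carrier → Carrier
  evenBinomialSum m u = Σ< F (suc (m / 2)) (λ r → ι F (m C (2 ℕ.* r)) * u ^ (2 ℕ.* r))
  oddBinomialSum  m u = Σ< F (suc ((m ℕ.∸ 1) / 2)) (λ r → ι F (m C (2 ℕ.* r ℕ.+ 1)) * u ^ (2 ℕ.* r ℕ.+ 1))

  evenBinomialSum+oddBinomialSum : ∀ m u → evenBinomialSum m u + oddBinomialSum m u ≈ (1# + u) ^ m
  evenBinomialSum+oddBinomialSum m u = begin
    evenBinomialSum m u + oddBinomialSum m u
      ≈⟨ +-cong (Σ<-vanishing-tail _ even-vanishes even-bound) (Σ<-vanishing-tail _ odd-vanishes odd-bound) ⟨
    Σ< F (suc m) (λ r → term (2 ℕ.* r)) + Σ< F (suc m) (λ r → term (2 ℕ.* r ℕ.+ 1))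
      ≈⟨ Σ<-even-odd (suc m) term ⟨
    Σ< F (2 ℕ.* suc m) term
      ≈⟨ Σ<-vanishing-tail term (λ j → binomialTerm-vanishes m u) (ℕₚ.m≤m+n (suc m) _) ⟩
    Σ< F (suc m) term
      ≈⟨ binomial-theorem m u ⟩
    (1# + u) ^ m ∎
    where
      term : ℕ → Carrier
      term j = ι F (m C j) * u ^ j

      even-bound : suc (m / 2) ℕ.≤ suc m
      even-bound = s≤s (m/n≤m m 2)

      even-vanishes : ∀ r → suc (m / 2) ℕ.≤ r → term (2 ℕ.* r) ≈ 0#
      even-vanishes r r>m/2 = binomialTerm-vanishes m u (ℕₚ.<-≤-trans (n<2*suc[n/2] m) (ℕₚ.*-monoʳ-≤ 2 r>m/2))

      odd-bound : suc ((m ℕ.∸ 1) / 2) ℕ.≤ suc m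
      odd-bound = s≤s (ℕₚ.≤-trans (m/n≤m (m ℕ.∸ 1) 2) (ℕₚ.m∸n≤m m 1))

      odd-vanishes : ∀ r → suc ((m ℕ.∸ 1) / 2) ℕ.≤ r → term (2 ℕ.* r ℕ.+ 1) ≈ 0#
      odd-vanishes r r>[m-1]/2 = binomialTerm-vanishes m u (ℕₚ.<-≤-trans (s≤s m≤2r) (ℕₚ.≤-reflexive (ℕₚ.+-comm 1 (2 ℕ.* r))))
        where
          m≤2r : m ℕ.≤ 2 ℕ.* r
          m≤2r = ℕₚ.≤-trans (ℕₚ.m≤n+m∸n m 1)
                   (ℕₚ.<-≤-trans (n<2*suc[n/2] (m ℕ.∸ 1)) (ℕₚ.*-monoʳ-≤ 2 r>[m-1]/2))

  evenBinomialSum-neg : ∀ m u → evenBinomialSum m (- u) ≈ evenBinomialSum m u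
  evenBinomialSum-neg m u = Σ<-cong (suc (m / 2)) (λ r → *-congˡ (-x^[2r]≈x^[2r] u r))

  oddBinomialSum-neg : ∀ m u → oddBinomialSum m (- u) ≈ - oddBinomialSum m u
  oddBinomialSum-neg m u = begin
    oddBinomialSum m (- u)                 ≈⟨ Σ<-cong R negate-term ⟩
    Σ< F R (λ r → - 1# * term r)           ≈⟨ *-distribˡ-Σ< R (- 1#) term ⟨
    - 1# * oddBinomialSum m u              ≈⟨ -1*x≈-x _ ⟩
    - oddBinomialSum m u                   ∎
    where
      R = suc ((m ℕ.∸ 1) / 2)

      term : ℕ → Carrier
      term r = ι F (m C (2 ℕ.* r ℕ.+ 1)) * u ^ (2 ℕ.* r ℕ.+ 1)

      negate-term : ∀ r → ι F (m C (2 ℕ.* r ℕ.+ 1)) * (- u) ^ (2 ℕ.* r ℕ.+ 1) ≈ - 1# * term r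
      negate-term r = begin
        ι F (m C (2 ℕ.* r ℕ.+ 1)) * (- u) ^ (2 ℕ.* r ℕ.+ 1)   ≈⟨ *-congˡ (-x^[2r+1]≈-x^[2r+1] u r) ⟩
        ι F (m C (2 ℕ.* r ℕ.+ 1)) * - u ^ (2 ℕ.* r ℕ.+ 1)     ≈⟨ -‿distribʳ-* _ _ ⟨
        - term r                                              ≈⟨ -1*x≈-x _ ⟨
        - 1# * term r                                         ∎

  evenBinomialSum-double : ∀ m u → evenBinomialSum m u + evenBinomialSum m u ≈ (1# + u) ^ m + (1# - u) ^ m
  evenBinomialSum-double m u = begin
    E + E                                                ≈⟨ [x+y]+[x-y]≈x+x E O ⟨
    (E + O) + (E - O)                                    ≈⟨ +-cong (evenBinomialSum+oddBinomialSum m u)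
                                                              (+-cong (sym (evenBinomialSum-neg m u)) (sym (oddBinomialSum-neg m u))) ⟩
    (1# + u) ^ m + (evenBinomialSum m (- u) + oddBinomialSum m (- u)) ≈⟨ +-congˡ (evenBinomialSum+oddBinomialSum m (- u)) ⟩
    (1# + u) ^ m + (1# - u) ^ m                          ∎
    where E = evenBinomialSum m u ; O = oddBinomialSum m u

  oddBinomialSum-double : ∀ m u → oddBinomialSum m u + oddBinomialSum m u ≈ (1# + u) ^ m - (1# - u) ^ m
  oddBinomialSum-double m u = begin
    O + O                                                ≈⟨ [x+y]-[x-y]≈y+y E O ⟨
    (E + O) - (E - O)                                    ≈⟨ +-cong (evenBinomialSum+oddBinomialSum m u)
                                                              (-‿cong (+-cong (sym (evenBinomialSum-neg m u)) (sym (oddBinomialSum-neg m u)))) ⟩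
    (1# + u) ^ m - (evenBinomialSum m (- u) + oddBinomialSum m (- u)) ≈⟨ +-congˡ (-‿cong (evenBinomialSum+oddBinomialSum m (- u))) ⟩
    (1# + u) ^ m - (1# - u) ^ m                          ∎
    where E = evenBinomialSum m u ; O = oddBinomialSum m u

  -- The solver sees ι F 2 as its unfolding 1# + (1# + 0#), hence con 1 :+ (con 1 :+ con 0) below.
  oddBinomialSum-scaled : ∀ m {b u p q} → b * (1# + u) ≈ ι F 2 * p → b * (1# - u) ≈ ι F 2 * q →
    b ^ suc m * oddBinomialSum (suc m) u ≈ ι F 2 ^ m * (p ^ suc m - q ^ suc m)
  oddBinomialSum-scaled m {b} {u} {p} {q} b[1+u]≈2p b[1-u]≈2q = *-cancelˡ-≉0 (ι-≉0 2) (begin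
    ι F 2 * (b ^ M * O)                          ≈⟨ solve 2 (λ b o → (con 1 :+ (con 1 :+ con 0)) :* (b :* o) := b :* (o :+ o)) refl (b ^ M) O ⟩
    b ^ M * (O + O)                              ≈⟨ *-congˡ (oddBinomialSum-double M u) ⟩
    b ^ M * ((1# + u) ^ M - (1# - u) ^ M)        ≈⟨ x[y-z]≈xy-xz _ _ _ ⟩
    b ^ M * (1# + u) ^ M - b ^ M * (1# - u) ^ M  ≈⟨ +-cong (x*y≈z*w⇒xⁿ*yⁿ≈zⁿ*wⁿ M b[1+u]≈2p)
                                                       (-‿cong (x*y≈z*w⇒xⁿ*yⁿ≈zⁿ*wⁿ M b[1-u]≈2q)) ⟩
    ι F 2 ^ M * p ^ M - ι F 2 ^ M * q ^ M        ≈⟨ x[y-z]≈xy-xz _ _ _ ⟨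
    ι F 2 ^ M * (p ^ M - q ^ M)                  ≈⟨ *-assoc _ _ _ ⟩
    ι F 2 * (ι F 2 ^ m * (p ^ M - q ^ M))        ∎)
    where M = suc m ; O = oddBinomialSum M u

  evenBinomialSum-scaled : ∀ m {b u p q} → b * (1# + u) ≈ ι F 2 * p → b * (1# - u) ≈ ι F 2 * q →
    b ^ suc m * evenBinomialSum (suc m) u ≈ ι F 2 ^ m * (p ^ suc m + q ^ suc m)
  evenBinomialSum-scaled m {b} {u} {p} {q} b[1+u]≈2p b[1-u]≈2q = *-cancelˡ-≉0 (ι-≉0 2) (begin
    ι F 2 * (b ^ M * E)                          ≈⟨ solve 2 (λ b e → (con 1 :+ (con 1 :+ con 0)) :* (b :* e) := b :* (e :+ e)) refl (b ^ M) E ⟩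
    b ^ M * (E + E)                              ≈⟨ *-congˡ (evenBinomialSum-double M u) ⟩
    b ^ M * ((1# + u) ^ M + (1# - u) ^ M)        ≈⟨ distribˡ _ _ _ ⟩
    b ^ M * (1# + u) ^ M + b ^ M * (1# - u) ^ M  ≈⟨ +-cong (x*y≈z*w⇒xⁿ*yⁿ≈zⁿ*wⁿ M b[1+u]≈2p)
                                                       (x*y≈z*w⇒xⁿ*yⁿ≈zⁿ*wⁿ M b[1-u]≈2q) ⟩
    ι F 2 ^ M * p ^ M + ι F 2 ^ M * q ^ M        ≈⟨ distribˡ _ _ _ ⟨
    ι F 2 ^ M * (p ^ M + q ^ M)                  ≈⟨ *-assoc _ _ _ ⟩
    ι F 2 * (ι F 2 ^ m * (p ^ M + q ^ M))        ∎)
    where M = suc m ; E = evenBinomialSum M u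

  -- binomPrev a k is binom a (k - 1), with the convention binom a (-1) = 0.
  binomPrev : Carrier → ℕ → Carrier
  binomPrev a zero    = 0#
  binomPrev a (suc k) = binom F a k

  falling[a,1+k]≈a*falling[a-1,k] : ∀ a k → falling F a (suc k) ≈ a * falling F (a - 1#) k
  falling[a,1+k]≈a*falling[a-1,k] a zero = begin
    1# * (a - 0#)   ≈⟨ *-congˡ (+-congˡ -0#≈0#) ⟩
    1# * (a + 0#)   ≈⟨ solve 1 (λ a → con 1 :* (a :+ con 0) := a :* con 1) refl a ⟩
    a * 1#          ∎
  falling[a,1+k]≈a*falling[a-1,k] a (suc k) = begin
    falling F a (suc k) * (a - (1# + ι F k))       ≈⟨ *-cong (falling[a,1+k]≈a*falling[a-1,k] a k) a-[1+k]≈[a-1]-k ⟩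
    (a * falling F (a - 1#) k) * ((a - 1#) - ι F k) ≈⟨ *-assoc _ _ _ ⟩
    a * falling F (a - 1#) (suc k)                  ∎
    where
      a-[1+k]≈[a-1]-k : a - (1# + ι F k) ≈ (a - 1#) - ι F k
      a-[1+k]≈[a-1]-k = trans (+-congˡ (sym (-‿+-comm 1# (ι F k)))) (sym (+-assoc _ _ _))

  binom[a,k]*k!≈falling[a,k] : ∀ a k → binom F a k * ι F (k !) ≈ falling F a k
  binom[a,k]*k!≈falling[a,k] a k = begin
    (falling F a k * K ⁻¹) * K ≈⟨ *-assoc _ _ _ ⟩
    falling F a k * (K ⁻¹ * K) ≈⟨ *-congˡ (trans (*-comm _ _) (⁻¹-inverse K (ι[k!]≉0 k))) ⟩
    falling F a k * 1#         ≈⟨ *-identityʳ _ ⟩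
    falling F a k              ∎
    where K = ι F (k !)

  binom[a,k]*[a-k]≈a*binom[a-1,k] : ∀ a k → binom F a k * (a - ι F k) ≈ a * binom F (a - 1#) k
  binom[a,k]*[a-k]≈a*binom[a-1,k] a k = *-cancelʳ-≉0 (ι[k!]≉0 k) (begin
    (binom F a k * (a - ι F k)) * K  ≈⟨ solve 3 (λ b x k → (b :* x) :* k := (b :* k) :* x) refl (binom F a k) (a - ι F k) K ⟩
    (binom F a k * K) * (a - ι F k)  ≈⟨ *-congʳ (binom[a,k]*k!≈falling[a,k] a k) ⟩
    falling F a (suc k)              ≈⟨ falling[a,1+k]≈a*falling[a-1,k] a k ⟩
    a * falling F (a - 1#) k         ≈⟨ *-congˡ (binom[a,k]*k!≈falling[a,k] (a - 1#) k) ⟨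
    a * (binom F (a - 1#) k * K)     ≈⟨ *-assoc _ _ _ ⟨
    (a * binom F (a - 1#) k) * K     ∎)
    where K = ι F (k !)

  binom[a,k]*k≈a*binomPrev[a-1,k] : ∀ a k → binom F a k * ι F k ≈ a * binomPrev (a - 1#) k
  binom[a,k]*k≈a*binomPrev[a-1,k] a zero    = trans (zeroʳ _) (sym (zeroʳ a))
  binom[a,k]*k≈a*binomPrev[a-1,k] a (suc k) = *-cancelʳ-≉0 (ι[k!]≉0 k) (begin
    (binom F a (suc k) * ι F (suc k)) * K  ≈⟨ *-assoc _ _ _ ⟩
    binom F a (suc k) * (ι F (suc k) * K)  ≈⟨ *-congˡ (×1-homo-* (suc k) (k !)) ⟨
    binom F a (suc k) * ι F (suc k !)      ≈⟨ binom[a,k]*k!≈falling[a,k] a (suc k) ⟩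
    falling F a (suc k)                    ≈⟨ falling[a,1+k]≈a*falling[a-1,k] a k ⟩
    a * falling F (a - 1#) k               ≈⟨ *-congˡ (binom[a,k]*k!≈falling[a,k] (a - 1#) k) ⟨
    a * (binom F (a - 1#) k * K)           ≈⟨ *-assoc _ _ _ ⟨
    (a * binom F (a - 1#) k) * K           ∎)
    where K = ι F (k !)

  module _ {a c} (c*a≈2 : c * a ≈ ι F 2) where

    binom[a,k]*[1+t]≈2*binom[a-1,k] : ∀ k → binom F a k * (1# + (1# - c * ι F k)) ≈ ι F 2 * binom F (a - 1#) k
    binom[a,k]*[1+t]≈2*binom[a-1,k] k = begin
      b * (1# + (1# - c * ι F k))  ≈⟨ *-congˡ (solve 1 (λ x → con 1 :+ (con 1 :+ x) := (con 1 :+ (con 1 :+ con 0)) :+ x) refl _) ⟩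
      b * (ι F 2 - c * ι F k)      ≈⟨ *-congˡ (+-cong (sym c*a≈2) (-‿distribʳ-* c (ι F k))) ⟩
      b * (c * a + c * - ι F k)    ≈⟨ *-congˡ (distribˡ c a (- ι F k)) ⟨
      b * (c * (a - ι F k))        ≈⟨ solve 3 (λ b c x → b :* (c :* x) := c :* (b :* x)) refl b c (a - ι F k) ⟩
      c * (b * (a - ι F k))        ≈⟨ *-congˡ (binom[a,k]*[a-k]≈a*binom[a-1,k] a k) ⟩
      c * (a * binom F (a - 1#) k) ≈⟨ *-assoc _ _ _ ⟨
      (c * a) * binom F (a - 1#) k ≈⟨ *-congʳ c*a≈2 ⟩
      ι F 2 * binom F (a - 1#) k   ∎
      where b = binom F a k

    binom[a,k]*[1-t]≈2*binomPrev[a-1,k] : ∀ k → binom F a k * (1# - (1# - c * ι F k)) ≈ ι F 2 * binomPrev (a - 1#) k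
    binom[a,k]*[1-t]≈2*binomPrev[a-1,k] k = begin
      b * (1# - (1# - c * ι F k))      ≈⟨ *-congˡ (1-[1-x]≈x (c * ι F k)) ⟩
      b * (c * ι F k)                  ≈⟨ solve 3 (λ b c x → b :* (c :* x) := c :* (b :* x)) refl b c (ι F k) ⟩
      c * (b * ι F k)                  ≈⟨ *-congˡ (binom[a,k]*k≈a*binomPrev[a-1,k] a k) ⟩
      c * (a * binomPrev (a - 1#) k)   ≈⟨ *-assoc _ _ _ ⟨
      (c * a) * binomPrev (a - 1#) k   ≈⟨ *-congʳ c*a≈2 ⟩
      ι F 2 * binomPrev (a - 1#) k     ∎
      where b = binom F a k

    odd-identity : ∀ m n →
      Σ< F (suc n) (λ k → binom F a k ^ suc m * oddBinomialSum (suc m) (1# - c * ι F k))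
        ≈ ι F (2 ℕ.^ m) * binom F (a - 1#) n ^ suc m
    odd-identity m n = begin
      Σ< F (suc n) (λ k → binom F a k ^ suc m * oddBinomialSum (suc m) (1# - c * ι F k))
        ≈⟨ Σ<-cong (suc n) (λ k → oddBinomialSum-scaled m (binom[a,k]*[1+t]≈2*binom[a-1,k] k)
                                                         (binom[a,k]*[1-t]≈2*binomPrev[a-1,k] k)) ⟩
      Σ< F (suc n) (λ k → ι F 2 ^ m * (g (suc k) - g k))
        ≈⟨ *-distribˡ-Σ< (suc n) (ι F 2 ^ m) _ ⟨
      ι F 2 ^ m * Σ< F (suc n) (λ k → g (suc k) - g k)
        ≈⟨ *-cong (sym (ι-homo-^ 2 m)) (Σ<-telescope (suc n) g) ⟩
      ι F (2 ℕ.^ m) * (g (suc n) - 0# ^ suc m)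
        ≈⟨ *-congˡ (trans (+-congˡ (trans (-‿cong (zeroˡ _)) -0#≈0#)) (+-identityʳ _)) ⟩
      ι F (2 ℕ.^ m) * g (suc n) ∎
      where
        g : ℕ → Carrier
        g k = binomPrev (a - 1#) k ^ suc m

    even-identity : ∀ m n →
      Σ< F (suc n) (λ k → (- 1#) ^ k * binom F a k ^ suc m * evenBinomialSum (suc m) (1# - c * ι F k))
        ≈ ι F (2 ℕ.^ m) * (- 1#) ^ n * binom F (a - 1#) n ^ suc m
    even-identity m n = begin
      Σ< F (suc n) (λ k → (- 1#) ^ k * binom F a k ^ suc m * evenBinomialSum (suc m) (1# - c * ι F k))
        ≈⟨ Σ<-cong (suc n) term ⟩
      Σ< F (suc n) (λ k → ι F 2 ^ m * ((- 1#) ^ k * (g (suc k) + g k)))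
        ≈⟨ *-distribˡ-Σ< (suc n) (ι F 2 ^ m) _ ⟨
      ι F 2 ^ m * Σ< F (suc n) (λ k → (- 1#) ^ k * (g (suc k) + g k))
        ≈⟨ *-cong (sym (ι-homo-^ 2 m)) (Σ<-alternating-telescope n g) ⟩
      ι F (2 ℕ.^ m) * (0# ^ suc m + (- 1#) ^ n * g (suc n))
        ≈⟨ *-congˡ (trans (+-congʳ (zeroˡ _)) (+-identityˡ _)) ⟩
      ι F (2 ℕ.^ m) * ((- 1#) ^ n * g (suc n))
        ≈⟨ *-assoc _ _ _ ⟨
      ι F (2 ℕ.^ m) * (- 1#) ^ n * g (suc n) ∎
      where
        g : ℕ → Carrier
        g k = binomPrev (a - 1#) k ^ suc m

        term : ∀ k → (- 1#) ^ k * binom F a k ^ suc m * evenBinomialSum (suc m) (1# - c * ι F k)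
                       ≈ ι F 2 ^ m * ((- 1#) ^ k * (g (suc k) + g k))
        term k = begin
          (- 1#) ^ k * binom F a k ^ suc m * evenBinomialSum (suc m) (1# - c * ι F k)
            ≈⟨ *-assoc _ _ _ ⟩
          (- 1#) ^ k * (binom F a k ^ suc m * evenBinomialSum (suc m) (1# - c * ι F k))
            ≈⟨ *-congˡ (evenBinomialSum-scaled m (binom[a,k]*[1+t]≈2*binom[a-1,k] k)
                                                  (binom[a,k]*[1-t]≈2*binomPrev[a-1,k] k)) ⟩
          (- 1#) ^ k * (ι F 2 ^ m * (g (suc k) + g k))
            ≈⟨ x∙yz≈y∙xz _ _ _ ⟩
          ι F 2 ^ m * ((- 1#) ^ k * (g (suc k) + g k)) ∎

lemma2p1 : ∀ {c ℓ} (F : CharZeroField c ℓ) (m n : ℕ) → .{{NonZero m}} → .{{NonZero n}} →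
    (a : CharZeroField.Carrier F) → ¬ (CharZeroField._≈_ F a (CharZeroField.0# F)) →
    Lemma2p1 F m n a
lemma2p1 F zero    n       a a≉0 = ⊥-elim (ℕ.≢-nonZero⁻¹ 0 ≡.refl)
lemma2p1 F (suc m) zero    a a≉0 = ⊥-elim (ℕ.≢-nonZero⁻¹ 0 ≡.refl)
lemma2p1 F (suc m) (suc n) a a≉0 = odd-identity F 2a⁻¹*a≈2 m n , even-identity F 2a⁻¹*a≈2 m n
  where 2a⁻¹*a≈2 = x*a⁻¹*a≈x F a≉0 (ι F 2)
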